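{- Fix $d\in\{1,2,3,7,11\}$ and let $x\in\mathbb{Q}(\sqrt{ -d})$. Then elements $R_1,\ldots,R_n$ with $R_n=x$ are the consecutive convergents of some complex continued fraction expansion of $x$ with partial quotients in $\mathbb{Z}[\omega_d]$ (i.e. there are $a_0,\ldots,a_{n-1}\in\mathbb{Z}[\omega_d]$ with $R_k=[a_0;a_1,\ldots,a_{k-1}]$ for $k=1,\ldots,n$) if and only if $\infty\to R_1\to\cdots\to R_n$ is a walk in $\mathcal{E}_d$ from $\infty$ to $x$.
   Context: $\omega_d=\sqrt{ -d}$ for $d\in\{1,2\}$, $\omega_d=\frac{1+\sqrt{ -d}}2$ for $d\in\{3,7,11\}$. $[a_0;a_1,\ldots,a_m]=a_0+\cfrac{1}{a_1+\cfrac{1}{\ddots+\cfrac1{a_m}}}$; its convergents are $[a_0;a_1,\ldots,a_k]$, $0\le k\le m$. The Farey graph $\mathcal{E}_d$ has vertex set $\mathbb{Q}(\sqrt{ -d})\cup\{\infty\}$ and edges $A(\infty)\to A(0)$ for $A\in\mathrm{PSL}(2,\mathbb{Z}[\omega_d])$ acting by Möbius transformations. A walk is a sequence of consecutive edges. -}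

module Defs where

open import Data.Nat using (ℕ; zero; suc)
open import Data.Integer as ℤ using (ℤ; +_; -[1+_])
open import Data.Rational as ℚ using (ℚ; 0ℚ; 1ℚ; _/_; ≢-nonZero)
open import Data.Rational.Properties using (_≟_)
open import Data.Maybe using (Maybe; just; nothing)
open import Data.Fin using (Fin; zero; suc; inject₁)
import Data.List
import Relation.Nullary
open import Data.Product using (_×_; _,_; Σ; ∃)
open import Relation.Nullary using (yes; no)
open import Relation.Binary.PropositionalEquality using (_≡_; _≢_)

data D : Set where
  d1 d2 d3 d7 d11 : D

-- ω² = α + β·ω  (β = trace of ω, -α = norm of ω)
-- d ∈ {1,2}: ω = √-d,        ω² = -d
-- d ∈ {3,7,11}: ω = (1+√-d)/2, ω² = ω - (1+d)/4
α : D → ℤ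
α d1  = ℤ.- (+ 1)
α d2  = ℤ.- (+ 2)
α d3  = ℤ.- (+ 1)
α d7  = ℤ.- (+ 2)
α d11 = ℤ.- (+ 3)

β : D → ℤ
β d1  = + 0
β d2  = + 0
β d3  = + 1
β d7  = + 1
β d11 = + 1

-- The ring ℤ[ω_d]: re + im·ω_d with re, im ∈ ℤ

record ℤω (d : D) : Set where
  constructor ⟪_,_⟫
  field
    re im : ℤ

-- The field ℚ(√-d) = ℚ(ω_d): re + im·ω_d with re, im ∈ ℚ

record K (d : D) : Set where
  constructor ⟨_,_⟩
  field
    re im : ℚ

module _ {d : D} where

  αℚ βℚ : ℚ
  αℚ = α d / 1
  βℚ = β d / 1

  0K 1K : K d
  0K = ⟨ 0ℚ , 0ℚ ⟩
  1K = ⟨ 1ℚ , 0ℚ ⟩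

  infixl 6 _+K_ _-K_
  infixl 7 _*K_

  _+K_ : K d → K d → K d
  ⟨ p , q ⟩ +K ⟨ r , s ⟩ = ⟨ p ℚ.+ r , q ℚ.+ s ⟩

  -K_ : K d → K d
  -K ⟨ p , q ⟩ = ⟨ ℚ.- p , ℚ.- q ⟩

  _-K_ : K d → K d → K d
  x -K y = x +K (-K y)

  -- (p + qω)(r + sω) = pr + (ps + qr)ω + qs(α + βω)
  _*K_ : K d → K d → K d
  ⟨ p , q ⟩ *K ⟨ r , s ⟩ =
    ⟨ p ℚ.* r ℚ.+ q ℚ.* s ℚ.* αℚ , p ℚ.* s ℚ.+ q ℚ.* r ℚ.+ q ℚ.* s ℚ.* βℚ ⟩

  -- Galois conjugate: conj(ω) = β - ω
  conj : K d → K d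
  conj ⟨ p , q ⟩ = ⟨ p ℚ.+ βℚ ℚ.* q , ℚ.- q ⟩

  -- Norm N(p + qω) = (p+qω)·conj(p+qω) = p² + βpq - αq²  (∈ ℚ)
  norm : K d → ℚ
  norm ⟨ p , q ⟩ = p ℚ.* p ℚ.+ βℚ ℚ.* p ℚ.* q ℚ.- αℚ ℚ.* q ℚ.* q

  -- Multiplicative inverse (junk value 0 at 0; never used at 0 below)
  invK : K d → K d
  invK x with norm x ≟ 0ℚ
  ... | yes _ = 0K
  ... | no ne = let n⁻¹ = ℚ.1/_ (norm x) {{≢-nonZero ne}} in
                conj x *K ⟨ n⁻¹ , 0ℚ ⟩

  _÷K_ : K d → K d → K d
  x ÷K y = x *K invK y

  isZero : K d → Set
  isZero x = x ≡ 0K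

  ι : ℤω d → K d
  ι ⟪ m , n ⟫ = ⟨ m / 1 , n / 1 ⟩

module _ {d : D} where

  infixl 6 _+Z_ _-Z_
  infixl 7 _*Z_

  _+Z_ : ℤω d → ℤω d → ℤω d
  ⟪ p , q ⟫ +Z ⟪ r , s ⟫ = ⟪ p ℤ.+ r , q ℤ.+ s ⟫

  _-Z_ : ℤω d → ℤω d → ℤω d
  ⟪ p , q ⟫ -Z ⟪ r , s ⟫ = ⟪ p ℤ.- r , q ℤ.- s ⟫

  _*Z_ : ℤω d → ℤω d → ℤω d
  ⟪ p , q ⟫ *Z ⟪ r , s ⟫ =
    ⟪ p ℤ.* r ℤ.+ q ℤ.* s ℤ.* α d , p ℤ.* s ℤ.+ q ℤ.* r ℤ.+ q ℤ.* s ℤ.* β d ⟫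

  1Z : ℤω d
  1Z = ⟪ + 1 , + 0 ⟫

-- The extended field ℚ(√-d) ∪ {∞}: nothing = ∞

P¹ : D → Set
P¹ d = Maybe (K d)

∞ : {d : D} → P¹ d
∞ = nothing

module _ {d : D} where

  isZero? : (x : K d) → Relation.Nullary.Dec (x ≡ 0K)
  isZero? ⟨ p , q ⟩ with p ≟ 0ℚ | q ≟ 0ℚ
  ... | yes Relation.Binary.PropositionalEquality.refl | yes Relation.Binary.PropositionalEquality.refl = yes Relation.Binary.PropositionalEquality.refl
  ... | no ne | _ = no λ { Relation.Binary.PropositionalEquality.refl → ne Relation.Binary.PropositionalEquality.refl }
  ... | yes _ | no ne = no λ { Relation.Binary.PropositionalEquality.refl → ne Relation.Binary.PropositionalEquality.refl }

  inv∞ : P¹ d → P¹ d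
  inv∞ nothing = just 0K
  inv∞ (just x) with isZero? x
  ... | yes _ = nothing
  ... | no _  = just (invK x)

  add∞ : K d → P¹ d → P¹ d
  add∞ a nothing  = nothing
  add∞ a (just x) = just (a +K x)

  proj : K d → K d → P¹ d
  proj u v with isZero? v
  ... | yes _ = nothing
  ... | no _  = just (u ÷K v)

-- Matrices in SL(2, ℤ[ω_d]) acting by Möbius transformations.
-- (PSL(2,ℤ[ω]) = SL(2,ℤ[ω])/{±I}; ±A act identically, so quantifying
-- over SL(2) elements gives the same edge set.)

record SL₂ (d : D) : Set where
  constructor mat
  field
    a b c e : ℤω d
    det≡1   : a *Z e -Z b *Z c ≡ 1Z

module _ {d : D} where

  möb : SL₂ d → P¹ d → P¹ d
  möb (mat a b c e _) nothing  = proj (ι a) (ι c)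
  möb (mat a b c e _) (just z) = proj (ι a *K z +K ι b) (ι c *K z +K ι e)

  Edge : P¹ d → P¹ d → Set
  Edge z w = Σ (SL₂ d) λ A → (möb A ∞ ≡ z) × (möb A (just 0K) ≡ w)

  -- Continued fraction [a₀; a₁, …, a_m] evaluated in ℚ(√-d) ∪ {∞}
  -- (with the conventions 1/0 = ∞, 1/∞ = 0, a + ∞ = ∞), given as a
  -- nonempty list a₀ ∷ [a₁, …, a_m].
  cf : ℤω d → Data.List.List (ℤω d) → P¹ d
  cf a₀ Data.List.[]       = just (ι a₀)
  cf a₀ (a₁ Data.List.∷ as) = add∞ (ι a₀) (inv∞ (cf a₁ as))

  IsWalk : {m : ℕ} → (Fin (suc m) → P¹ d) → Set
  IsWalk {m} v = (i : Fin m) → Edge (v (inject₁ i)) (v (suc i))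

{-# OPTIONS --safe #-}
-- The map T a : z ↦ a + 1/z is the Möbius transformation of the matrix (a 1; 1 0) of
-- determinant −1. If det N = −1 then N A diag(1, −1) ∈ SL₂ for every A ∈ SL₂, and it agrees
-- with N ∘ A at ∞ and 0; so T a and its inverse z ↦ 1/(z − a) map edges A(∞) → A(0) of 𝓔_d to
-- edges. The neighbours of ∞ are exactly the elements of ℤ[ω] (A(∞) = ∞ forces A upper
-- triangular). Since [a₀; a₁, …, a_k] = T a₀ [a₁; …, a_k], applying T a₀ to the walk of
-- convergents of (a₁, …) and prepending ∞ → a₀ = T a₀ ∞ gives the walk for (a₀, a₁, …);
-- conversely, applying z ↦ 1/(z − R₀) to a walk ∞ → R₀ → R₁ → ⋯ gives a shorter walk from ∞.
module Submission where

open import Defs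
open import Level using (0ℓ)
open import Data.Nat using (ℕ; zero; suc)
open import Data.Fin using (Fin; zero; suc; toℕ; fromℕ; inject₁)
open import Data.List using (take; tabulate)
open import Data.Vec.Functional using (_∷_)
open import Data.Maybe as Maybe using (just; nothing)
open import Data.Product using (Σ; _×_; _,_; uncurry)
open import Data.Empty using (⊥-elim)
open import Function using (_∘_)
open import Function.Bundles using (_⇔_; mk⇔)
open import Relation.Nullary using (¬_; yes; no)
open import Relation.Nullary.Decidable using (dec⇒maybe)
open import Relation.Binary.PropositionalEquality
open import Data.Integer as ℤ using (ℤ; +0; +[1+_]; -[1+_])
import Data.Integer.Properties as ℤ
open import Data.Rational as ℚ using (ℚ; 0ℚ; 1ℚ; mkℚ; _+_; _*_; -_; Positive; NonNegative)
import Data.Rational.Properties as ℚ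
import Data.Nat.Coprimality as Coprimality
open import Algebra.Bundles using (CommutativeRing)
import Algebra.Solver.Ring
import Algebra.Solver.Ring.AlmostCommutativeRing as Solver
import Tactic.RingSolver.Core.AlmostCommutativeRing as Tactic
open import Tactic.RingSolver using (solve-∀)

open ≡-Reasoning

ℚ-ring : Tactic.AlmostCommutativeRing 0ℓ 0ℓ
ℚ-ring = Tactic.fromCommutativeRing ℚ.+-*-commutativeRing λ p → Maybe.map sym (dec⇒maybe (p ℚ.≟ 0ℚ))

fromℤ : ℤ → ℚ
fromℤ m = mkℚ m 0 (Coprimality.sym (Coprimality.1-coprimeTo ℤ.∣ m ∣))

/1≡fromℤ : ∀ m → m ℚ./ 1 ≡ fromℤ m
/1≡fromℤ m = ℚ.↥p/↧p≡p (fromℤ m)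

/1-homo-+ : ∀ m n → (m ℤ.+ n) ℚ./ 1 ≡ (m ℚ./ 1) + (n ℚ./ 1)
/1-homo-+ m n rewrite /1≡fromℤ m | /1≡fromℤ n | ℤ.*-identityʳ m | ℤ.*-identityʳ n = refl

/1-homo-* : ∀ m n → (m ℤ.* n) ℚ./ 1 ≡ (m ℚ./ 1) * (n ℚ./ 1)
/1-homo-* m n rewrite /1≡fromℤ m | /1≡fromℤ n = refl

/1-homo-neg : ∀ m → (ℤ.- m) ℚ./ 1 ≡ - (m ℚ./ 1)
/1-homo-neg m rewrite /1≡fromℤ m | /1≡fromℤ (ℤ.- m) = fromℤ-neg m
  where
  fromℤ-neg : ∀ m → fromℤ (ℤ.- m) ≡ - fromℤ m
  fromℤ-neg +0       = refl
  fromℤ-neg +[1+ n ] = refl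
  fromℤ-neg -[1+ n ] = refl

/1-homo-- : ∀ m n → (m ℤ.- n) ℚ./ 1 ≡ (m ℚ./ 1) ℚ.- (n ℚ./ 1)
/1-homo-- m n = trans (/1-homo-+ m (ℤ.- n)) (cong (λ t → (m ℚ./ 1) + t) (/1-homo-neg n))

/1-injective : ∀ m n → m ℚ./ 1 ≡ n ℚ./ 1 → m ≡ n
/1-injective m n eq rewrite /1≡fromℤ m | /1≡fromℤ n = cong ℚ.↥_ eq

pos⇒≢0 : ∀ p → .{{Positive p}} → p ≢ 0ℚ
pos⇒≢0 p p≡0 = ℚ.<-irrefl (sym p≡0) (ℚ.positive⁻¹ p)

p*p-nonNeg : ∀ p → NonNegative (p * p)
p*p-nonNeg p@(mkℚ (ℤ.+ _) _ _) = ℚ.nonNeg*nonNeg⇒nonNeg p p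
p*p-nonNeg p@(mkℚ -[1+ _ ] _ _) = ℚ.nonPos*nonPos⇒nonPos p p  -- misnamed: it concludes NonNegative

p*p-pos : ∀ p → p ≢ 0ℚ → Positive (p * p)
p*p-pos p@(mkℚ +[1+ _ ] _ _) _   = ℚ.pos*pos⇒pos p p
p*p-pos p@(mkℚ -[1+ _ ] _ _) _   = ℚ.neg*neg⇒pos p p
p*p-pos p@(mkℚ +0 _ _)       p≢0 = ⊥-elim (p≢0 (ℚ.↥p≡0⇒p≡0 p refl))

p*p≡0⇒p≡0 : ∀ p → p * p ≡ 0ℚ → p ≡ 0ℚ
p*p≡0⇒p≡0 p p*p≡0 with p ℚ.≟ 0ℚ
... | yes p≡0 = p≡0
... | no  p≢0 = ⊥-elim (pos⇒≢0 (p * p) {{p*p-pos p p≢0}} p*p≡0)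

p*p+c*q*q≡0⇒q≡0 : ∀ c .{{_ : Positive c}} p q → p * p + c * (q * q) ≡ 0ℚ → q ≡ 0ℚ
p*p+c*q*q≡0⇒q≡0 c p q eq with q ℚ.≟ 0ℚ
... | yes q≡0 = q≡0
... | no  q≢0 = ⊥-elim (pos⇒≢0 _ {{sum-pos}} eq)
  where
  sum-pos : Positive (p * p + c * (q * q))
  sum-pos = ℚ.nonNeg+pos⇒pos (p * p) {{p*p-nonNeg p}} (c * (q * q))
              {{ℚ.pos*pos⇒pos c (q * q) {{p*p-pos q q≢0}}}}

module _ {d : D} where
  open import Algebra.Definitions {A = K d} _≡_
  open import Algebra.Structures {A = K d} _≡_ using (IsAbelianGroup)

  +K-assoc : Associative _+K_
  +K-assoc ⟨ p , q ⟩ ⟨ r , s ⟩ ⟨ t , u ⟩ = cong₂ ⟨_,_⟩ (ℚ.+-assoc p r t) (ℚ.+-assoc q s u)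

  +K-comm : Commutative _+K_
  +K-comm ⟨ p , q ⟩ ⟨ r , s ⟩ = cong₂ ⟨_,_⟩ (ℚ.+-comm p r) (ℚ.+-comm q s)

  +K-identityˡ : LeftIdentity 0K _+K_
  +K-identityˡ ⟨ p , q ⟩ = cong₂ ⟨_,_⟩ (ℚ.+-identityˡ p) (ℚ.+-identityˡ q)

  +K-identityʳ : RightIdentity 0K _+K_
  +K-identityʳ ⟨ p , q ⟩ = cong₂ ⟨_,_⟩ (ℚ.+-identityʳ p) (ℚ.+-identityʳ q)

  -K-inverseˡ : LeftInverse 0K (λ x → -K x) _+K_
  -K-inverseˡ ⟨ p , q ⟩ = cong₂ ⟨_,_⟩ (ℚ.+-inverseˡ p) (ℚ.+-inverseˡ q)

  -K-inverseʳ : RightInverse 0K (λ x → -K x) _+K_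
  -K-inverseʳ ⟨ p , q ⟩ = cong₂ ⟨_,_⟩ (ℚ.+-inverseʳ p) (ℚ.+-inverseʳ q)

  +K-isAbelianGroup : IsAbelianGroup _+K_ 0K (λ x → -K x)
  +K-isAbelianGroup = record
    { isGroup = record
      { isMonoid = record
        { isSemigroup = record
          { isMagma = record { isEquivalence = isEquivalence ; ∙-cong = cong₂ _+K_ }
          ; assoc = +K-assoc }
        ; identity = +K-identityˡ , +K-identityʳ }
      ; inverse = -K-inverseˡ , -K-inverseʳ
      ; ⁻¹-cong = cong (λ x → -K x) }
    ; comm = +K-comm }

  *K-assoc : Associative _*K_
  *K-assoc ⟨ p , q ⟩ ⟨ r , s ⟩ ⟨ t , u ⟩ =
    cong₂ ⟨_,_⟩ (re (αℚ {d}) (βℚ {d}) p q r s t u) (im (αℚ {d}) (βℚ {d}) p q r s t u)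
    where
    re : ∀ a b p q r s t u →
      (p * r + q * s * a) * t + (p * s + q * r + q * s * b) * u * a ≡
      p * (r * t + s * u * a) + q * (r * u + s * t + s * u * b) * a
    re = solve-∀ ℚ-ring
    im : ∀ a b p q r s t u →
      (p * r + q * s * a) * u + (p * s + q * r + q * s * b) * t + (p * s + q * r + q * s * b) * u * b ≡
      p * (r * u + s * t + s * u * b) + q * (r * t + s * u * a) + q * (r * u + s * t + s * u * b) * b
    im = solve-∀ ℚ-ring

  *K-comm : Commutative _*K_
  *K-comm ⟨ p , q ⟩ ⟨ r , s ⟩ = cong₂ ⟨_,_⟩ (re (αℚ {d}) p q r s) (im (βℚ {d}) p q r s)
    where
    re : ∀ a p q r s → p * r + q * s * a ≡ r * p + s * q * a
    re = solve-∀ ℚ-ring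
    im : ∀ b p q r s → p * s + q * r + q * s * b ≡ r * q + s * p + s * q * b
    im = solve-∀ ℚ-ring

  *K-identityˡ : LeftIdentity 1K _*K_
  *K-identityˡ ⟨ r , s ⟩ = cong₂ ⟨_,_⟩ (re (αℚ {d}) r s) (im (βℚ {d}) r s)
    where
    re : ∀ a r s → 1ℚ * r + 0ℚ * s * a ≡ r
    re = solve-∀ ℚ-ring
    im : ∀ b r s → 1ℚ * s + 0ℚ * r + 0ℚ * s * b ≡ s
    im = solve-∀ ℚ-ring

  *K-distribˡ : _*K_ DistributesOverˡ _+K_
  *K-distribˡ ⟨ p , q ⟩ ⟨ r , s ⟩ ⟨ t , u ⟩ =
    cong₂ ⟨_,_⟩ (re (αℚ {d}) p q r s t u) (im (βℚ {d}) p q r s t u)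
    where
    re : ∀ a p q r s t u → p * (r + t) + q * (s + u) * a ≡ (p * r + q * s * a) + (p * t + q * u * a)
    re = solve-∀ ℚ-ring
    im : ∀ b p q r s t u →
      p * (s + u) + q * (r + t) + q * (s + u) * b ≡ (p * s + q * r + q * s * b) + (p * u + q * t + q * u * b)
    im = solve-∀ ℚ-ring

  K-commutativeRing : CommutativeRing 0ℓ 0ℓ
  K-commutativeRing = record
    { isCommutativeRing = record
      { isRing = record
        { +-isAbelianGroup = +K-isAbelianGroup
        ; *-cong = cong₂ _*K_
        ; *-assoc = *K-assoc
        ; *-identity = *K-identityˡ , λ x → trans (*K-comm x 1K) (*K-identityˡ x)
        ; distrib = *K-distribˡ , λ x y z →
            trans (*K-comm (y +K z) x) (trans (*K-distribˡ x y z) (cong₂ _+K_ (*K-comm x y) (*K-comm x z))) }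
      ; *-comm = *K-comm } }

  open CommutativeRing K-commutativeRing public
    using () renaming (*-identityʳ to *K-identityʳ; zeroˡ to *K-zeroˡ; zeroʳ to *K-zeroʳ)

  fromℚ : ℚ → K d
  fromℚ r = ⟨ r , 0ℚ ⟩

  fromℚ-homo-* : ∀ r s → fromℚ r *K fromℚ s ≡ fromℚ (r * s)
  fromℚ-homo-* r s = cong₂ ⟨_,_⟩ (re (αℚ {d}) r s) (im (βℚ {d}) r s)
    where
    re : ∀ a r s → r * s + 0ℚ * 0ℚ * a ≡ r * s
    re = solve-∀ ℚ-ring
    im : ∀ b r s → r * 0ℚ + 0ℚ * s + 0ℚ * 0ℚ * b ≡ 0ℚ
    im = solve-∀ ℚ-ring

  x*conj[x]≡norm[x] : ∀ x → x *K conj x ≡ fromℚ (norm x)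
  x*conj[x]≡norm[x] ⟨ p , q ⟩ = cong₂ ⟨_,_⟩ (re (αℚ {d}) (βℚ {d}) p q) (im (βℚ {d}) p q)
    where
    re : ∀ a b p q → p * (p + b * q) + q * (- q) * a ≡ p * p + b * p * q + - (a * q * q)
    re = solve-∀ ℚ-ring
    im : ∀ b p q → p * (- q) + q * (p + b * q) + q * (- q) * b ≡ 0ℚ
    im = solve-∀ ℚ-ring

-- Minus the discriminant of the minimal polynomial x² − βx − α of ω; positive as ω ∉ ℝ.
∣Δ∣ : D → ℚ
∣Δ∣ d = - (βℚ {d} * βℚ {d} + (ℤ.+ 4 ℚ./ 1) * αℚ {d})

∣Δ∣-positive : ∀ d → Positive (∣Δ∣ d)
∣Δ∣-positive d1  = _
∣Δ∣-positive d2  = _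
∣Δ∣-positive d3  = _
∣Δ∣-positive d7  = _
∣Δ∣-positive d11 = _

module _ {d : D} where

  norm≡0⇒≡0K : ∀ x → norm {d} x ≡ 0ℚ → x ≡ 0K
  norm≡0⇒≡0K ⟨ p , q ⟩ N≡0 = cong₂ ⟨_,_⟩ p≡0 q≡0
    where
    completed-square : ∀ a b p q →
      (ℤ.+ 4 ℚ./ 1) * (p * p + b * p * q + - (a * q * q)) ≡
      (p + p + b * q) * (p + p + b * q) + - (b * b + (ℤ.+ 4 ℚ./ 1) * a) * (q * q)
    completed-square = solve-∀ ℚ-ring
    norm-at-q≡0 : ∀ a b p → p * p + b * p * 0ℚ + - (a * 0ℚ * 0ℚ) ≡ p * p
    norm-at-q≡0 = solve-∀ ℚ-ring
    q≡0 : q ≡ 0ℚ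
    q≡0 = p*p+c*q*q≡0⇒q≡0 (∣Δ∣ d) {{∣Δ∣-positive d}} (p + p + βℚ {d} * q) q (begin
      _                                   ≡⟨ completed-square (αℚ {d}) (βℚ {d}) p q ⟨
      (ℤ.+ 4 ℚ./ 1) * norm {d} ⟨ p , q ⟩  ≡⟨ cong ((ℤ.+ 4 ℚ./ 1) *_) N≡0 ⟩
      (ℤ.+ 4 ℚ./ 1) * 0ℚ                  ≡⟨ ℚ.*-zeroʳ (ℤ.+ 4 ℚ./ 1) ⟩
      0ℚ                                  ∎)
    p≡0 : p ≡ 0ℚ
    p≡0 = p*p≡0⇒p≡0 p (begin
      p * p                ≡⟨ norm-at-q≡0 (αℚ {d}) (βℚ {d}) p ⟨
      norm {d} ⟨ p , 0ℚ ⟩  ≡⟨ cong (λ q → norm {d} ⟨ p , q ⟩) q≡0 ⟨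
      norm {d} ⟨ p , q ⟩   ≡⟨ N≡0 ⟩
      0ℚ                   ∎)

  1K≢0K : 1K {d} ≢ 0K
  1K≢0K 1≡0 = ℚ.1≢0 (cong K.re 1≡0)

  *K-inverseʳ : ∀ x → x ≢ 0K → x *K invK x ≡ 1K
  *K-inverseʳ x x≢0 with norm x ℚ.≟ 0ℚ
  ... | yes N≡0 = ⊥-elim (x≢0 (norm≡0⇒≡0K x N≡0))
  ... | no  N≢0 = begin
    x *K (conj x *K fromℚ N⁻¹)     ≡⟨ *K-assoc x (conj x) _ ⟨
    (x *K conj x) *K fromℚ N⁻¹     ≡⟨ cong (_*K fromℚ N⁻¹) (x*conj[x]≡norm[x] x) ⟩
    fromℚ (norm x) *K fromℚ N⁻¹    ≡⟨ fromℚ-homo-* (norm x) N⁻¹ ⟩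
    fromℚ (norm x * N⁻¹)           ≡⟨ cong fromℚ (ℚ.*-inverseʳ (norm x) {{ℚ.≢-nonZero N≢0}}) ⟩
    1K                             ∎
    where N⁻¹ = ℚ.1/_ (norm x) {{ℚ.≢-nonZero N≢0}}

  *K-inverseˡ : ∀ x → x ≢ 0K → invK x *K x ≡ 1K
  *K-inverseˡ x x≢0 = trans (*K-comm (invK x) x) (*K-inverseʳ x x≢0)

  x*y≡1⇒x≢0 : ∀ {x y} → x *K y ≡ 1K → x ≢ 0K
  x*y≡1⇒x≢0 {y = y} xy≡1 refl = 1K≢0K (trans (sym xy≡1) (*K-zeroˡ y))

  invK-unique : ∀ x y → x *K y ≡ 1K → invK x ≡ y
  invK-unique x y xy≡1 = begin
    invK x                   ≡⟨ *K-identityʳ (invK x) ⟨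
    invK x *K 1K             ≡⟨ cong (invK x *K_) xy≡1 ⟨
    invK x *K (x *K y)       ≡⟨ *K-assoc (invK x) x y ⟨
    (invK x *K x) *K y       ≡⟨ cong (_*K y) (*K-inverseˡ x (x*y≡1⇒x≢0 xy≡1)) ⟩
    1K *K y                  ≡⟨ *K-identityˡ y ⟩
    y                        ∎

  invK-1K : invK (1K {d}) ≡ 1K
  invK-1K = invK-unique 1K 1K (*K-identityˡ 1K)

  x≢0∧x*y≡0⇒y≡0 : ∀ x y → x ≢ 0K → x *K y ≡ 0K → y ≡ 0K
  x≢0∧x*y≡0⇒y≡0 x y x≢0 xy≡0 = begin
    y                        ≡⟨ *K-identityˡ y ⟨
    1K *K y                  ≡⟨ cong (_*K y) (*K-inverseˡ x x≢0) ⟨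
    (invK x *K x) *K y       ≡⟨ *K-assoc (invK x) x y ⟩
    invK x *K (x *K y)       ≡⟨ cong (invK x *K_) xy≡0 ⟩
    invK x *K 0K             ≡⟨ *K-zeroʳ (invK x) ⟩
    0K                       ∎

  *K-≢0 : ∀ x y → x ≢ 0K → y ≢ 0K → x *K y ≢ 0K
  *K-≢0 x y x≢0 y≢0 xy≡0 = y≢0 (x≢0∧x*y≡0⇒y≡0 x y x≢0 xy≡0)

module _ {d : D} where

  ι-homo-+ : ∀ (x y : ℤω d) → ι (x +Z y) ≡ ι x +K ι y
  ι-homo-+ ⟪ p , q ⟫ ⟪ r , s ⟫ = cong₂ ⟨_,_⟩ (/1-homo-+ p r) (/1-homo-+ q s)

  ι-homo-- : ∀ (x y : ℤω d) → ι (x -Z y) ≡ ι x -K ι y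
  ι-homo-- ⟪ p , q ⟫ ⟪ r , s ⟫ = cong₂ ⟨_,_⟩ (/1-homo-- p r) (/1-homo-- q s)

  ι-homo-* : ∀ (x y : ℤω d) → ι (x *Z y) ≡ ι x *K ι y
  ι-homo-* ⟪ p , q ⟫ ⟪ r , s ⟫ = cong₂ ⟨_,_⟩
    (trans (/1-homo-+ (p ℤ.* r) _) (cong₂ _+_ (/1-homo-* p r) (/1-homo-*³ q s (α d))))
    (trans (/1-homo-+ (p ℤ.* s ℤ.+ q ℤ.* r) _)
      (cong₂ _+_ (trans (/1-homo-+ (p ℤ.* s) _) (cong₂ _+_ (/1-homo-* p s) (/1-homo-* q r)))
                 (/1-homo-*³ q s (β d))))
    where
    /1-homo-*³ : ∀ l m n → (l ℤ.* m ℤ.* n) ℚ./ 1 ≡ (l ℚ./ 1) * (m ℚ./ 1) * (n ℚ./ 1)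
    /1-homo-*³ l m n = trans (/1-homo-* (l ℤ.* m) n) (cong (_* (n ℚ./ 1)) (/1-homo-* l m))

  ι-injective : ∀ (x y : ℤω d) → ι x ≡ ι y → x ≡ y
  ι-injective ⟪ p , q ⟫ ⟪ r , s ⟫ eq =
    cong₂ ⟪_,_⟫ (/1-injective p r (cong K.re eq)) (/1-injective q s (cong K.im eq))

  -- The solver normalises coefficients by evaluation; in ℚ(ω) itself this gets stuck on
  -- α d and β d for a variable d, so the coefficients are taken in ℤ.
  K-ring : Solver.AlmostCommutativeRing 0ℓ 0ℓ
  K-ring = Solver.fromCommutativeRing (K-commutativeRing {d})

  ιℤ : ℤ → K d
  ιℤ m = fromℚ (m ℚ./ 1)

  ℤ⟶K : ℤ.+-*-rawRing Solver.-Raw-AlmostCommutative⟶ K-ring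
  ℤ⟶K = record
    { ⟦_⟧    = ιℤ
    ; +-homo = λ m n → cong fromℚ (/1-homo-+ m n)
    ; *-homo = λ m n → trans (cong fromℚ (/1-homo-* m n)) (sym (fromℚ-homo-* (m ℚ./ 1) (n ℚ./ 1)))
    ; -‿homo = λ m → cong fromℚ (/1-homo-neg m)
    ; 0-homo = refl
    ; 1-homo = refl
    }

  module K-Solver = Algebra.Solver.Ring ℤ.+-*-rawRing K-ring ℤ⟶K
    (λ m n → Maybe.map (cong ιℤ) (dec⇒maybe (m ℤ.≟ n)))

  :0 :1 : ∀ {n} → K-Solver.Polynomial n
  :0 = K-Solver.con (ℤ.+ 0)
  :1 = K-Solver.con (ℤ.+ 1)

record Mat₂ (A : Set) : Set where
  constructor mat₂
  field a b c e : A

mapMat₂ : {A B : Set} → (A → B) → Mat₂ A → Mat₂ B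
mapMat₂ f (mat₂ a b c e) = mat₂ (f a) (f b) (f c) (f e)

mat₂-cong : {A : Set} {a b c e a′ b′ c′ e′ : A} →
  a ≡ a′ → b ≡ b′ → c ≡ c′ → e ≡ e′ → mat₂ a b c e ≡ mat₂ a′ b′ c′ e′
mat₂-cong refl refl refl refl = refl

module Mat₂-Ring {A : Set} (_⊕_ _⊖_ _⊛_ : A → A → A) where

  _⊗_ : Mat₂ A → Mat₂ A → Mat₂ A
  mat₂ a b c e ⊗ mat₂ a′ b′ c′ e′ =
    mat₂ ((a ⊛ a′) ⊕ (b ⊛ c′)) ((a ⊛ b′) ⊕ (b ⊛ e′))
         ((c ⊛ a′) ⊕ (e ⊛ c′)) ((c ⊛ b′) ⊕ (e ⊛ e′))

  det : Mat₂ A → A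
  det (mat₂ a b c e) = (a ⊛ e) ⊖ (b ⊛ c)

module _ {d : D} where
  open Mat₂-Ring (_+Z_ {d}) _-Z_ _*Z_ public renaming (_⊗_ to _*ᶻ_; det to detᶻ)
  open Mat₂-Ring (_+K_ {d}) _-K_ _*K_ public renaming (_⊗_ to _*ᴷ_; det to detᴷ)

  open K-Solver {d} using (solve; _:=_; _:+_; _:*_; _:-_)

  ιM : Mat₂ (ℤω d) → Mat₂ (K d)
  ιM = mapMat₂ ι

  ι-det : ∀ M → ι (detᶻ M) ≡ detᴷ (ιM M)
  ι-det (mat₂ a b c e) = trans (ι-homo-- (a *Z e) (b *Z c)) (cong₂ _-K_ (ι-homo-* a e) (ι-homo-* b c))

  ιM-homo-* : ∀ M N → ιM (M *ᶻ N) ≡ ιM M *ᴷ ιM N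
  ιM-homo-* (mat₂ a b c e) (mat₂ a′ b′ c′ e′) =
    mat₂-cong (ι-homo-*+* a a′ b c′) (ι-homo-*+* a b′ b e′)
              (ι-homo-*+* c a′ e c′) (ι-homo-*+* c b′ e e′)
    where
    ι-homo-*+* : ∀ x y z w → ι (x *Z y +Z z *Z w) ≡ ι x *K ι y +K ι z *K ι w
    ι-homo-*+* x y z w = trans (ι-homo-+ (x *Z y) (z *Z w)) (cong₂ _+K_ (ι-homo-* x y) (ι-homo-* z w))

  detᴷ-homo-* : ∀ M N → detᴷ (M *ᴷ N) ≡ detᴷ M *K detᴷ N
  detᴷ-homo-* (mat₂ a b c e) (mat₂ a′ b′ c′ e′) = det-identity a b c e a′ b′ c′ e′
    where
    det-identity : ∀ (a b c e a′ b′ c′ e′ : K d) →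
      (a *K a′ +K b *K c′) *K (c *K b′ +K e *K e′) -K (a *K b′ +K b *K e′) *K (c *K a′ +K e *K c′) ≡
      (a *K e -K b *K c) *K (a′ *K e′ -K b′ *K c′)
    det-identity = solve 8 (λ a b c e a′ b′ c′ e′ →
      (a :* a′ :+ b :* c′) :* (c :* b′ :+ e :* e′) :- (a :* b′ :+ b :* e′) :* (c :* a′ :+ e :* c′)
      := (a :* e :- b :* c) :* (a′ :* e′ :- b′ :* c′)) refl

  möbK : Mat₂ (K d) → P¹ d → P¹ d
  möbK (mat₂ a b c e) nothing  = proj a c
  möbK (mat₂ a b c e) (just z) = proj (a *K z +K b) (c *K z +K e)

  entries : SL₂ d → Mat₂ (ℤω d)
  entries (mat a b c e _) = mat₂ a b c e

  möb≡möbK : ∀ A z → möb A z ≡ möbK (ιM (entries A)) z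
  möb≡möbK (mat a b c e _) nothing  = refl
  möb≡möbK (mat a b c e _) (just z) = refl

  proj-0K : ∀ (u : K d) → proj u 0K ≡ ∞
  proj-0K u with isZero? (0K {d})
  ... | yes _   = refl
  ... | no  0≢0 = ⊥-elim (0≢0 refl)

  proj-≢0K : ∀ (u v : K d) → v ≢ 0K → proj u v ≡ just (u *K invK v)
  proj-≢0K u v v≢0 with isZero? v
  ... | yes v≡0 = ⊥-elim (v≢0 v≡0)
  ... | no  _   = refl

  proj≡∞⇒≡0K : ∀ (u v : K d) → proj u v ≡ ∞ → v ≡ 0K
  proj≡∞⇒≡0K u v eq with isZero? v
  ... | yes v≡0 = v≡0
  ... | no  _   with () ← eq

  proj-1K : ∀ (x : K d) → proj x 1K ≡ just x
  proj-1K x = trans (proj-≢0K x 1K 1K≢0K) (cong just (trans (cong (x *K_) invK-1K) (*K-identityʳ x)))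

  interchange : ∀ (x y z w : K d) → (x *K y) *K (z *K w) ≡ (x *K z) *K (y *K w)
  interchange = solve 4 (λ x y z w → (x :* y) :* (z :* w) := (x :* z) :* (y :* w)) refl

  invK-homo-* : ∀ (x y : K d) → x ≢ 0K → y ≢ 0K → invK (x *K y) ≡ invK x *K invK y
  invK-homo-* x y x≢0 y≢0 = invK-unique (x *K y) (invK x *K invK y) (begin
    (x *K y) *K (invK x *K invK y)    ≡⟨ interchange x y (invK x) (invK y) ⟩
    (x *K invK x) *K (y *K invK y)    ≡⟨ cong₂ _*K_ (*K-inverseʳ x x≢0) (*K-inverseʳ y y≢0) ⟩
    1K *K 1K                          ≡⟨ *K-identityˡ 1K ⟩
    1K                                ∎)

  proj-scale : ∀ (l u v : K d) → l ≢ 0K → proj (l *K u) (l *K v) ≡ proj u v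
  proj-scale l u v l≢0 with isZero? v
  ... | yes refl = trans (cong (proj (l *K u)) (*K-zeroʳ l)) (proj-0K (l *K u))
  ... | no  v≢0  = trans (proj-≢0K (l *K u) (l *K v) (*K-≢0 l v l≢0 v≢0)) (cong just (begin
    (l *K u) *K invK (l *K v)         ≡⟨ cong ((l *K u) *K_) (invK-homo-* l v l≢0 v≢0) ⟩
    (l *K u) *K (invK l *K invK v)    ≡⟨ interchange l u (invK l) (invK v) ⟩
    (l *K invK l) *K (u *K invK v)    ≡⟨ cong (_*K (u *K invK v)) (*K-inverseʳ l l≢0) ⟩
    1K *K (u *K invK v)               ≡⟨ *K-identityˡ _ ⟩
    u *K invK v                       ∎))

  Nonzero₂ : K d × K d → Set
  Nonzero₂ (u , v) = ¬ (u ≡ 0K × v ≡ 0K)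

  homog : P¹ d → K d × K d
  homog nothing  = (1K , 0K)
  homog (just x) = (x , 1K)

  homog-nonzero : ∀ z → Nonzero₂ (homog z)
  homog-nonzero nothing  (1≡0 , _) = 1K≢0K 1≡0
  homog-nonzero (just x) (_ , 1≡0) = 1K≢0K 1≡0

  proj-homog : ∀ z → uncurry proj (homog z) ≡ z
  proj-homog nothing  = proj-0K 1K
  proj-homog (just x) = proj-1K x

  infixr 5 _·_
  _·_ : Mat₂ (K d) → K d × K d → K d × K d
  mat₂ a b c e · (u , v) = (a *K u +K b *K v , c *K u +K e *K v)

  ·-assoc : ∀ M N w → M · N · w ≡ (M *ᴷ N) · w
  ·-assoc (mat₂ a b c e) (mat₂ a′ b′ c′ e′) (u , v) =
    cong₂ _,_ (row a b a′ b′ c′ e′ u v) (row c e a′ b′ c′ e′ u v)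
    where
    row : ∀ (x y a′ b′ c′ e′ u v : K d) →
      x *K (a′ *K u +K b′ *K v) +K y *K (c′ *K u +K e′ *K v) ≡
      (x *K a′ +K y *K c′) *K u +K (x *K b′ +K y *K e′) *K v
    row = solve 8 (λ x y a′ b′ c′ e′ u v →
      x :* (a′ :* u :+ b′ :* v) :+ y :* (c′ :* u :+ e′ :* v)
      := (x :* a′ :+ y :* c′) :* u :+ (x :* b′ :+ y :* e′) :* v) refl

  -- Cramer's rule: (det M) w is a linear combination of the entries of M w.
  ·-nonzero : ∀ M w → detᴷ M ≢ 0K → Nonzero₂ w → Nonzero₂ (M · w)
  ·-nonzero (mat₂ a b c e) (u , v) det≢0 w≢0 (s≡0 , t≡0) = w≢0 (u≡0 , v≡0)
    where
    cramer₁ : ∀ (a b c e u v : K d) →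
      e *K (a *K u +K b *K v) -K b *K (c *K u +K e *K v) ≡ (a *K e -K b *K c) *K u
    cramer₁ = solve 6 (λ a b c e u v →
      e :* (a :* u :+ b :* v) :- b :* (c :* u :+ e :* v) := (a :* e :- b :* c) :* u) refl
    cramer₂ : ∀ (a b c e u v : K d) →
      a *K (c *K u +K e *K v) -K c *K (a *K u +K b *K v) ≡ (a *K e -K b *K c) *K v
    cramer₂ = solve 6 (λ a b c e u v →
      a :* (c :* u :+ e :* v) :- c :* (a :* u :+ b :* v) := (a :* e :- b :* c) :* v) refl
    x*0-y*0≡0 : ∀ (x y : K d) → x *K 0K -K y *K 0K ≡ 0K
    x*0-y*0≡0 = solve 2 (λ x y → x :* :0 :- y :* :0 := :0) refl
    u≡0 : u ≡ 0K
    u≡0 = x≢0∧x*y≡0⇒y≡0 _ u det≢0 (begin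
      (a *K e -K b *K c) *K u                              ≡⟨ cramer₁ a b c e u v ⟨
      e *K (a *K u +K b *K v) -K b *K (c *K u +K e *K v)   ≡⟨ cong₂ (λ s t → e *K s -K b *K t) s≡0 t≡0 ⟩
      e *K 0K -K b *K 0K                                   ≡⟨ x*0-y*0≡0 e b ⟩
      0K                                                   ∎)
    v≡0 : v ≡ 0K
    v≡0 = x≢0∧x*y≡0⇒y≡0 _ v det≢0 (begin
      (a *K e -K b *K c) *K v                              ≡⟨ cramer₂ a b c e u v ⟨
      a *K (c *K u +K e *K v) -K c *K (a *K u +K b *K v)   ≡⟨ cong₂ (λ s t → a *K s -K c *K t) t≡0 s≡0 ⟩
      a *K 0K -K c *K 0K                                   ≡⟨ x*0-y*0≡0 a c ⟩
      0K                                                   ∎)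

  möbK-proj : ∀ M w → Nonzero₂ w → möbK M (uncurry proj w) ≡ uncurry proj (M · w)
  möbK-proj (mat₂ a b c e) (u , v) w≢0 with isZero? v
  ... | yes refl = sym (trans (cong₂ proj (at-∞ a b u) (at-∞ c e u)) (proj-scale u a c u≢0))
    where
    u≢0 : u ≢ 0K
    u≢0 u≡0 = w≢0 (u≡0 , refl)
    at-∞ : ∀ (x y u : K d) → x *K u +K y *K 0K ≡ u *K x
    at-∞ = solve 3 (λ x y u → x :* u :+ y :* :0 := u :* x) refl
  ... | no v≢0 = sym (trans (cong₂ proj (at-finite a b) (at-finite c e)) (proj-scale v _ _ v≢0))
    where
    at-finite : ∀ x y → x *K u +K y *K v ≡ v *K (x *K (u *K invK v) +K y)
    at-finite x y = begin
      x *K u +K y *K v                       ≡⟨ cong (_+K y *K v) (*K-identityʳ (x *K u)) ⟨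
      x *K u *K 1K +K y *K v                 ≡⟨ cong (λ t → x *K u *K t +K y *K v) (*K-inverseʳ v v≢0) ⟨
      x *K u *K (v *K invK v) +K y *K v      ≡⟨ identity x y u v (invK v) ⟨
      v *K (x *K (u *K invK v) +K y)         ∎
      where
      identity : ∀ (x y u v w : K d) → v *K (x *K (u *K w) +K y) ≡ x *K u *K (v *K w) +K y *K v
      identity = solve 5 (λ x y u v w → v :* (x :* (u :* w) :+ y) := x :* u :* (v :* w) :+ y :* v) refl

  möbK-homog : ∀ M z → möbK M z ≡ uncurry proj (M · homog z)
  möbK-homog M z = trans (cong (möbK M) (sym (proj-homog z))) (möbK-proj M (homog z) (homog-nonzero z))

  möbK-homo-* : ∀ M N z → detᴷ N ≢ 0K → möbK M (möbK N z) ≡ möbK (M *ᴷ N) z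
  möbK-homo-* M N z det≢0 = begin
    möbK M (möbK N z)                   ≡⟨ cong (möbK M) (möbK-homog N z) ⟩
    möbK M (uncurry proj (N · homog z)) ≡⟨ möbK-proj M _ (·-nonzero N (homog z) det≢0 (homog-nonzero z)) ⟩
    uncurry proj (M · N · homog z)      ≡⟨ cong (uncurry proj) (·-assoc M N (homog z)) ⟩
    uncurry proj ((M *ᴷ N) · homog z)   ≡⟨ möbK-homog (M *ᴷ N) z ⟨
    möbK (M *ᴷ N) z                     ∎

module _ {d : D} where
  open K-Solver {d} using (solve; _:=_; _:+_; _:*_; _:-_; :-_; con)

  0Z -1Z : ℤω d
  0Z  = ⟪ ℤ.+ 0 , ℤ.+ 0 ⟫
  -1Z = ⟪ -[1+ 0 ] , ℤ.+ 0 ⟫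

  -1K≢0K : -K 1K ≢ 0K {d}
  -1K≢0K -1≡0 = 1K≢0K (cong (λ x → -K x) -1≡0)

  ≡-1K⇒≢0K : ∀ {x : K d} → x ≡ -K 1K → x ≢ 0K
  ≡-1K⇒≢0K x≡-1 x≡0 = -1K≢0K (trans (sym x≡-1) x≡0)

  x*0+y≡y : ∀ (x y : K d) → x *K 0K +K y ≡ y
  x*0+y≡y = solve 2 (λ x y → x :* :0 :+ y := y) refl

  toSL₂ : (M : Mat₂ (ℤω d)) → detᶻ M ≡ 1Z → SL₂ d
  toSL₂ (mat₂ a b c e) det≡1 = mat a b c e det≡1

  detᴷ-SL₂ : ∀ (A : SL₂ d) → detᴷ (ιM (entries A)) ≡ 1K
  detᴷ-SL₂ (mat a b c e det≡1) = trans (sym (ι-det (mat₂ a b c e))) (cong ι det≡1)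

  Neg : Mat₂ (ℤω d)
  Neg = mat₂ 1Z 0Z 0Z -1Z

  detᴷ-Neg : detᴷ (ιM Neg) ≡ -K 1K
  detᴷ-Neg = solve 0 (:1 :* con -[1+ 0 ] :- :0 :* :0 := :- :1) refl

  möbK-Neg-∞ : möbK (ιM Neg) ∞ ≡ ∞
  möbK-Neg-∞ = proj-0K 1K

  möbK-Neg-0 : möbK (ιM Neg) (just 0K) ≡ just 0K
  möbK-Neg-0 = begin
    proj (1K *K 0K +K 0K) (0K *K 0K +K -K 1K)  ≡⟨ cong₂ proj (x*0+y≡y 1K 0K) (x*0+y≡y 0K (-K 1K)) ⟩
    proj 0K (-K 1K)                            ≡⟨ proj-≢0K 0K (-K 1K) -1K≢0K ⟩
    just (0K *K invK (-K 1K))                  ≡⟨ cong just (*K-zeroˡ (invK (-K 1K))) ⟩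
    just 0K                                    ∎

  -- For det N = −1 the matrix N A Neg lies in SL₂, and it acts as N ∘ A at ∞ and 0, the fixed
  -- points of Neg.
  Edge-image : (N : Mat₂ (ℤω d)) → detᴷ (ιM N) ≡ -K 1K →
               ∀ {z w} → Edge z w → Edge (möbK (ιM N) z) (möbK (ιM N) w)
  Edge-image N det[N]≡-1 (A , A∞≡z , A0≡w) =
    B , B-acts ∞ A∞≡z möbK-Neg-∞ , B-acts (just 0K) A0≡w möbK-Neg-0
    where
    A′ = entries A
    N′ = ιM N
    A″ = ιM A′
    Neg′ = ιM Neg
    ιM-NANeg : ιM (N *ᶻ (A′ *ᶻ Neg)) ≡ N′ *ᴷ (A″ *ᴷ Neg′)
    ιM-NANeg = trans (ιM-homo-* N (A′ *ᶻ Neg)) (cong (N′ *ᴷ_) (ιM-homo-* A′ Neg))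
    det[ANeg]≡-1 : detᴷ (A″ *ᴷ Neg′) ≡ -K 1K
    det[ANeg]≡-1 = begin
      detᴷ (A″ *ᴷ Neg′)          ≡⟨ detᴷ-homo-* A″ Neg′ ⟩
      detᴷ A″ *K detᴷ Neg′       ≡⟨ cong₂ _*K_ (detᴷ-SL₂ A) detᴷ-Neg ⟩
      1K *K -K 1K                ≡⟨ *K-identityˡ (-K 1K) ⟩
      -K 1K                      ∎
    det[NANeg]≡1 : detᶻ (N *ᶻ (A′ *ᶻ Neg)) ≡ 1Z
    det[NANeg]≡1 = ι-injective (detᶻ (N *ᶻ (A′ *ᶻ Neg))) 1Z (begin
      ι (detᶻ (N *ᶻ (A′ *ᶻ Neg)))       ≡⟨ ι-det (N *ᶻ (A′ *ᶻ Neg)) ⟩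
      detᴷ (ιM (N *ᶻ (A′ *ᶻ Neg)))      ≡⟨ cong detᴷ ιM-NANeg ⟩
      detᴷ (N′ *ᴷ (A″ *ᴷ Neg′))         ≡⟨ detᴷ-homo-* N′ (A″ *ᴷ Neg′) ⟩
      detᴷ N′ *K detᴷ (A″ *ᴷ Neg′)      ≡⟨ cong₂ _*K_ det[N]≡-1 det[ANeg]≡-1 ⟩
      -K 1K *K -K 1K                    ≡⟨ solve 0 (:- :1 :* :- :1 := :1) refl ⟩
      1K                                ∎)
    B : SL₂ d
    B = toSL₂ (N *ᶻ (A′ *ᶻ Neg)) det[NANeg]≡1
    B-acts : ∀ u {v} → möb A u ≡ v → möbK Neg′ u ≡ u → möb B u ≡ möbK N′ v
    B-acts u {v} Au≡v Neg-u≡u = begin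
      möb B u                               ≡⟨ möb≡möbK B u ⟩
      möbK (ιM (N *ᶻ (A′ *ᶻ Neg))) u        ≡⟨ cong (λ M → möbK M u) ιM-NANeg ⟩
      möbK (N′ *ᴷ (A″ *ᴷ Neg′)) u           ≡⟨ möbK-homo-* N′ _ u (≡-1K⇒≢0K det[ANeg]≡-1) ⟨
      möbK N′ (möbK (A″ *ᴷ Neg′) u)         ≡⟨ cong (möbK N′) (möbK-homo-* A″ Neg′ u (≡-1K⇒≢0K detᴷ-Neg)) ⟨
      möbK N′ (möbK A″ (möbK Neg′ u))       ≡⟨ cong (λ t → möbK N′ (möbK A″ t)) Neg-u≡u ⟩
      möbK N′ (möbK A″ u)                   ≡⟨ cong (möbK N′) (trans (sym (möb≡möbK A u)) Au≡v) ⟩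
      möbK N′ v                             ∎

  Edge-∞-ℤω : (b : ℤω d) → Edge ∞ (just (ι b))
  Edge-∞-ℤω b = toSL₂ (mat₂ 1Z b 0Z 1Z) det≡1 , proj-0K 1K , (begin
    proj (1K *K 0K +K ι b) (0K *K 0K +K 1K)   ≡⟨ cong₂ proj (x*0+y≡y 1K (ι b)) (x*0+y≡y 0K 1K) ⟩
    proj (ι b) 1K                             ≡⟨ proj-1K (ι b) ⟩
    just (ι b)                                ∎)
    where
    det≡1 : 1Z *Z 1Z -Z b *Z 0Z ≡ 1Z
    det≡1 = ι-injective (1Z *Z 1Z -Z b *Z 0Z) 1Z (trans (ι-det (mat₂ 1Z b 0Z 1Z)) (identity (ι b)))
      where
      identity : ∀ (x : K d) → 1K *K 1K -K x *K 0K ≡ 1K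
      identity = solve 1 (λ x → :1 :* :1 :- x :* :0 := :1) refl

  -- A fixes ∞ only if it is upper triangular, and then A(0) = b/e = b a.
  Edge-∞⇒ℤω : ∀ {z} → Edge ∞ z → Σ (ℤω d) (λ b → z ≡ just (ι b))
  Edge-∞⇒ℤω {z} (mat a b c e det≡1 , A∞≡∞ , A0≡z) = b *Z a , (begin
    z                                             ≡⟨ A0≡z ⟨
    proj (ι a *K 0K +K ι b) (ι c *K 0K +K ι e)    ≡⟨ cong₂ proj (x*0+y≡y (ι a) (ι b)) (x*0+y≡y (ι c) (ι e)) ⟩
    proj (ι b) (ι e)                              ≡⟨ proj-≢0K (ι b) (ι e) (x*y≡1⇒x≢0 ea≡1) ⟩
    just (ι b *K invK (ι e))                      ≡⟨ cong (just ∘ (ι b *K_)) (invK-unique (ι e) (ι a) ea≡1) ⟩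
    just (ι b *K ι a)                             ≡⟨ cong just (ι-homo-* b a) ⟨
    just (ι (b *Z a))                             ∎)
    where
    ιc≡0 : ι c ≡ 0K
    ιc≡0 = proj≡∞⇒≡0K (ι a) (ι c) A∞≡∞
    ea≡1 : ι e *K ι a ≡ 1K
    ea≡1 = begin
      ι e *K ι a                     ≡⟨ identity (ι e) (ι a) (ι b) ⟩
      ι a *K ι e -K ι b *K 0K        ≡⟨ cong (λ t → ι a *K ι e -K ι b *K t) ιc≡0 ⟨
      ι a *K ι e -K ι b *K ι c       ≡⟨ ι-det (mat₂ a b c e) ⟨
      ι (a *Z e -Z b *Z c)           ≡⟨ cong ι det≡1 ⟩
      1K                             ∎
      where
      identity : ∀ (x y z : K d) → x *K y ≡ y *K x -K z *K 0K
      identity = solve 3 (λ x y z → x :* y := y :* x :- z :* :0) refl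

module _ {d : D} where
  open K-Solver {d} using (solve; _:=_; _:+_; _:*_; _:-_; :-_)

  T : K d → P¹ d → P¹ d
  T x z = add∞ x (inv∞ z)

  Tᴷ T⁻¹ᴷ : K d → Mat₂ (K d)
  Tᴷ x   = mat₂ x 1K 1K 0K
  T⁻¹ᴷ x = mat₂ 0K 1K 1K (-K x)

  T⁻¹ : K d → P¹ d → P¹ d
  T⁻¹ x = möbK (T⁻¹ᴷ x)

  T≗möbK-Tᴷ : ∀ x z → T x z ≡ möbK (Tᴷ x) z
  T≗möbK-Tᴷ x nothing = trans (cong just (+K-identityʳ x)) (sym (proj-1K x))
  T≗möbK-Tᴷ x (just y) with isZero? y
  ... | yes refl = sym (trans (cong₂ proj (x*0+y≡y x 1K) (x*0+y≡y 1K 0K)) (proj-0K 1K))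
  ... | no  y≢0  = sym (begin
    proj (x *K y +K 1K) (1K *K y +K 0K)     ≡⟨ cong (proj (x *K y +K 1K)) (trans (+K-identityʳ _) (*K-identityˡ y)) ⟩
    proj (x *K y +K 1K) y                   ≡⟨ proj-≢0K _ y y≢0 ⟩
    just ((x *K y +K 1K) *K invK y)         ≡⟨ cong just (identity x y (invK y)) ⟩
    just (x *K (y *K invK y) +K invK y)     ≡⟨ cong (λ t → just (x *K t +K invK y)) (*K-inverseʳ y y≢0) ⟩
    just (x *K 1K +K invK y)                ≡⟨ cong (λ t → just (t +K invK y)) (*K-identityʳ x) ⟩
    just (x +K invK y)                      ∎)
    where
    identity : ∀ (x y w : K d) → (x *K y +K 1K) *K w ≡ x *K (y *K w) +K w
    identity = solve 3 (λ x y w → (x :* y :+ :1) :* w := x :* (y :* w) :+ w) refl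

  T⁻¹-x≡∞ : ∀ x → T⁻¹ x (just x) ≡ ∞
  T⁻¹-x≡∞ x = trans (cong₂ proj (identity₁ x) (identity₂ x)) (proj-0K 1K)
    where
    identity₁ : ∀ (x : K d) → 0K *K x +K 1K ≡ 1K
    identity₁ = solve 1 (λ x → :0 :* x :+ :1 := :1) refl
    identity₂ : ∀ (x : K d) → 1K *K x +K -K x ≡ 0K
    identity₂ = solve 1 (λ x → :1 :* x :+ :- x := :0) refl

  Iᴷ : Mat₂ (K d)
  Iᴷ = mat₂ 1K 0K 0K 1K

  möbK-Iᴷ : ∀ z → möbK Iᴷ z ≡ z
  möbK-Iᴷ nothing  = proj-0K 1K
  möbK-Iᴷ (just x) = trans (cong₂ proj (identity₁ x) (identity₂ x)) (proj-1K x)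
    where
    identity₁ : ∀ (x : K d) → 1K *K x +K 0K ≡ x
    identity₁ = solve 1 (λ x → :1 :* x :+ :0 := x) refl
    identity₂ : ∀ (x : K d) → 0K *K x +K 1K ≡ 1K
    identity₂ = solve 1 (λ x → :0 :* x :+ :1 := :1) refl

  Tᴷ*T⁻¹ᴷ≡Iᴷ : ∀ x → Tᴷ x *ᴷ T⁻¹ᴷ x ≡ Iᴷ
  Tᴷ*T⁻¹ᴷ≡Iᴷ x = mat₂-cong (a x) (b x) (c x) (e x)
    where
    a : ∀ (x : K d) → x *K 0K +K 1K *K 1K ≡ 1K
    a = solve 1 (λ x → x :* :0 :+ :1 :* :1 := :1) refl
    b : ∀ (x : K d) → x *K 1K +K 1K *K -K x ≡ 0K
    b = solve 1 (λ x → x :* :1 :+ :1 :* :- x := :0) refl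
    c : ∀ (x : K d) → 1K *K 0K +K 0K *K 1K ≡ 0K
    c = solve 1 (λ x → :1 :* :0 :+ :0 :* :1 := :0) refl
    e : ∀ (x : K d) → 1K *K 1K +K 0K *K -K x ≡ 1K
    e = solve 1 (λ x → :1 :* :1 :+ :0 :* :- x := :1) refl

  detᴷ-Tᴷ : ∀ x → detᴷ (Tᴷ x) ≡ -K 1K
  detᴷ-Tᴷ = solve 1 (λ x → x :* :0 :- :1 :* :1 := :- :1) refl

  detᴷ-T⁻¹ᴷ : ∀ x → detᴷ (T⁻¹ᴷ x) ≡ -K 1K
  detᴷ-T⁻¹ᴷ = solve 1 (λ x → :0 :* :- x :- :1 :* :1 := :- :1) refl

  T∘T⁻¹ : ∀ x z → T x (T⁻¹ x z) ≡ z
  T∘T⁻¹ x z = begin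
    T x (T⁻¹ x z)                    ≡⟨ T≗möbK-Tᴷ x (T⁻¹ x z) ⟩
    möbK (Tᴷ x) (möbK (T⁻¹ᴷ x) z)    ≡⟨ möbK-homo-* (Tᴷ x) (T⁻¹ᴷ x) z (≡-1K⇒≢0K (detᴷ-T⁻¹ᴷ x)) ⟩
    möbK (Tᴷ x *ᴷ T⁻¹ᴷ x) z          ≡⟨ cong (λ M → möbK M z) (Tᴷ*T⁻¹ᴷ≡Iᴷ x) ⟩
    möbK Iᴷ z                        ≡⟨ möbK-Iᴷ z ⟩
    z                                ∎

  T-Edge : ∀ a {z w} → Edge z w → Edge (T (ι a) z) (T (ι a) w)
  T-Edge a {z} {w} z→w = subst₂ Edge (sym (T≗möbK-Tᴷ (ι a) z)) (sym (T≗möbK-Tᴷ (ι a) w))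
    (Edge-image (mat₂ a 1Z 1Z 0Z) (detᴷ-Tᴷ (ι a)) z→w)

  T⁻¹-Edge : ∀ a {z w} → Edge z w → Edge (T⁻¹ (ι a) z) (T⁻¹ (ι a) w)
  T⁻¹-Edge a {z} {w} z→w = subst (λ M → Edge (möbK M z) (möbK M w)) ιM≡T⁻¹ᴷ
    (Edge-image (mat₂ 0Z 1Z 1Z (0Z -Z a)) (trans (cong detᴷ ιM≡T⁻¹ᴷ) (detᴷ-T⁻¹ᴷ (ι a))) z→w)
    where
    ιM≡T⁻¹ᴷ : ιM (mat₂ 0Z 1Z 1Z (0Z -Z a)) ≡ T⁻¹ᴷ (ι a)
    ιM≡T⁻¹ᴷ = cong (mat₂ 0K 1K 1K) (trans (ι-homo-- 0Z a) (+K-identityˡ (-K ι a)))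

  IsWalk-∷ : ∀ {m u} {v : Fin (suc m) → P¹ d} → Edge u (v zero) → IsWalk v → IsWalk (u ∷ v)
  IsWalk-∷ u→v₀ W zero    = u→v₀
  IsWalk-∷ u→v₀ W (suc i) = W i

  IsWalk-map : ∀ {m} (f : P¹ d → P¹ d) → (∀ {z w} → Edge z w → Edge (f z) (f w)) →
               (v : Fin (suc m) → P¹ d) → IsWalk v → IsWalk (f ∘ v)
  IsWalk-map f f-Edge v W i = f-Edge (W i)

  IsWalk-resp : ∀ {m} {v w : Fin (suc m) → P¹ d} → (∀ i → v i ≡ w i) → IsWalk v → IsWalk w
  IsWalk-resp v≗w W i = subst₂ Edge (v≗w (inject₁ i)) (v≗w (suc i)) (W i)

  convergents : ∀ {n} → (Fin (suc n) → ℤω d) → Fin (suc n) → P¹ d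
  convergents {n} a i = cf (a zero) (take (toℕ i) (tabulate (λ (j : Fin n) → a (suc j))))

  convergents-suc : ∀ {n} (a : Fin (suc (suc n)) → ℤω d) i →
                    convergents a (suc i) ≡ T (ι (a zero)) (convergents (a ∘ suc) i)
  convergents-suc a i = refl

  convergents-walk : ∀ n (a : Fin (suc n) → ℤω d) → IsWalk (∞ ∷ convergents a)
  convergents-walk zero    a = IsWalk-∷ (Edge-∞-ℤω (a zero)) λ ()
  convergents-walk (suc n) a = IsWalk-∷ (Edge-∞-ℤω (a zero))
    (IsWalk-resp shifted (IsWalk-map (T (ι (a zero))) (T-Edge (a zero))
                                     (∞ ∷ convergents (a ∘ suc)) (convergents-walk n (a ∘ suc))))
    where
    shifted : ∀ i → T (ι (a zero)) ((∞ ∷ convergents (a ∘ suc)) i) ≡ convergents a i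
    shifted zero    = cong just (+K-identityʳ (ι (a zero)))
    shifted (suc i) = sym (convergents-suc a i)

  walk-T⁻¹ : ∀ {m} (R : Fin (suc (suc m)) → P¹ d) b → R zero ≡ just (ι b) →
             IsWalk (∞ ∷ R) → IsWalk (∞ ∷ (T⁻¹ (ι b) ∘ R ∘ suc))
  walk-T⁻¹ R b R₀≡b W = IsWalk-resp moved (IsWalk-map (T⁻¹ (ι b)) (T⁻¹-Edge b) R (W ∘ suc))
    where
    moved : ∀ i → T⁻¹ (ι b) (R i) ≡ (∞ ∷ (T⁻¹ (ι b) ∘ R ∘ suc)) i
    moved zero    = trans (cong (T⁻¹ (ι b)) R₀≡b) (T⁻¹-x≡∞ (ι b))
    moved (suc i) = refl

  walk⇒convergents : ∀ n (R : Fin (suc n) → P¹ d) → IsWalk (∞ ∷ R) →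
                     Σ (Fin (suc n) → ℤω d) (λ a → ∀ i → R i ≡ convergents a i)
  walk⇒convergents zero    R W =
    let (b , R₀≡b) = Edge-∞⇒ℤω (W zero) in (λ _ → b) , λ { zero → R₀≡b }
  walk⇒convergents (suc n) R W = prepend (Edge-∞⇒ℤω (W zero))
    where
    prepend : Σ (ℤω d) (λ b → R zero ≡ just (ι b)) →
              Σ (Fin (suc (suc n)) → ℤω d) (λ a → ∀ i → R i ≡ convergents a i)
    prepend (b , R₀≡b) =
      let (a , R′≡conv) = walk⇒convergents n (T⁻¹ (ι b) ∘ R ∘ suc) (walk-T⁻¹ R b R₀≡b W) in
      (b ∷ a) , λ
        { zero    → R₀≡b
        ; (suc i) → trans (sym (T∘T⁻¹ (ι b) (R (suc i)))) (cong (T (ι b)) (R′≡conv i)) }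

theorem1 : (d : D) (x : K d) (n : ℕ) (R : Fin (suc n) → P¹ d) →
    R (fromℕ n) ≡ just x →
    (Σ (Fin (suc n) → ℤω d) (λ a →
        (i : Fin (suc n)) →
          R i ≡ cf (a zero) (take (toℕ i) (tabulate (λ (j : Fin n) → a (suc j)))))
     ⇔ IsWalk (∞ ∷ R))
theorem1 d x n R _ = mk⇔
  (λ (a , R≡conv) → IsWalk-resp {v = ∞ ∷ convergents a} {w = ∞ ∷ R}
                      (λ { zero → refl ; (suc i) → sym (R≡conv i) }) (convergents-walk n a))
  (walk⇒convergents n R)
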